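{- Let $\lambda,m,n,h,k$ be positive integers with $h\le n$, $k\le m$, $nk=mh$ and $3=\frac{2nk}{\lambda}+1$. Then there exists a ${}^\lambda\mathrm{NH}(m,n;h,k)$ over $\mathbb{Z}_3$ (relative to the trivial subgroup).
   Context: An $m\times n$ partially filled (p.f.) array over a group $G$ (written additively) is an $m\times n$ matrix each of whose cells is empty or contains an element of $G$. For a subgroup $J$ of order $t$, a ${}^\lambda\mathrm{NH}_t(m,n;h,k)$ over $G$ relative to $J$ is an $m\times n$ p.f. array $A$ over $G$ such that: (a) each row contains exactly $h$ filled cells and each column exactly $k$ filled cells; (b) the multiset obtained by taking, for every filled cell with entry $x$, both $x$ and $-x$ (with multiplicity), is exactly the multiset containing each element of $G\setminus J$ exactly $\lambda$ times; (c) each row sum (left to right) and each column sum (top to bottom) is nonzero. When $t=1$ the subscript is omitted. -}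

module Defs where

open import Data.Nat using (ℕ; zero; suc; _+_; _∸_; NonZero)
open import Data.Nat.DivMod using (_mod_)
open import Data.Fin using (Fin; toℕ; _≟_)
open import Data.Maybe using (Maybe; just; nothing)
open import Relation.Nullary using (¬_; yes; no)
open import Relation.Binary.PropositionalEquality using (_≡_)
open import Data.Product using (_×_)

Σℕ : (n : ℕ) → (Fin n → ℕ) → ℕ
Σℕ zero    f = 0
Σℕ (suc n) f = f Fin.zero + Σℕ n (λ i → f (Fin.suc i))

module Zmod (v : ℕ) .{{_ : NonZero v}} where
  Z : Set
  Z = Fin v

  0z : Z
  0z = 0 mod v

  _+z_ : Z → Z → Z
  a +z b = (toℕ a + toℕ b) mod v

  -z_ : Z → Z
  -z a = (v ∸ toℕ a) mod v

  ΣZ : (n : ℕ) → (Fin n → Maybe Z) → Z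
  ΣZ zero    f = 0z
  ΣZ (suc n) f with f Fin.zero
  ... | nothing = ΣZ n (λ i → f (Fin.suc i))
  ... | just x  = x +z ΣZ n (λ i → f (Fin.suc i))

  filled : Maybe Z → ℕ
  filled nothing  = 0
  filled (just _) = 1

  isG : Z → Maybe Z → ℕ
  isG g nothing = 0
  isG g (just x) with x ≟ g
  ... | yes _ = 1
  ... | no  _ = 0

  PFArray : ℕ → ℕ → Set
  PFArray m n = Fin m → Fin n → Maybe Z

  -- Multiplicity of g in the multiset {x, -x : x a filled entry of A}.
  mult : ∀ {m n} → PFArray m n → Z → ℕ
  mult {m} {n} A g =
    Σℕ m (λ i → Σℕ n (λ j → isG g (A i j) + isG (-z g) (A i j)))

  rowSum : ∀ {m n} → PFArray m n → Fin m → Z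
  rowSum {m} {n} A i = ΣZ n (λ j → A i j)

  colSum : ∀ {m n} → PFArray m n → Fin n → Z
  colSum {m} {n} A j = ΣZ m (λ i → A i j)

  -- ^λ NH(m,n;h,k) over ℤ_v relative to the trivial subgroup J = {0} (t = 1).
  record IsNH (lam m n h k : ℕ) (A : PFArray m n) : Set where
    field
      rowFilled : ∀ i → Σℕ n (λ j → filled (A i j)) ≡ h
      colFilled : ∀ j → Σℕ m (λ i → filled (A i j)) ≡ k
      multJ     : mult A 0z ≡ 0
      multOut   : ∀ g → ¬ (g ≡ 0z) → mult A g ≡ lam
      rowNZ     : ∀ i → ¬ (rowSum A i ≡ 0z)
      colNZ     : ∀ j → ¬ (colSum A j ≡ 0z)

-- Since λ = nk = mh is the number of filled cells, the multiplicity condition says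
-- exactly that every filled cell is nonzero; so one has to fill an array with the
-- entries 1 and 2 so that all row and column sums are nonzero mod 3.  A line with
-- ℓ filled cells, β of which hold 2, has sum ℓ + β.  Fill the cells cyclically:
-- the t-th filled cell (t < mh = nk) lies in row ⌊t/h⌋ and column t mod n, and
-- holds 1 + b(t) with
--   b(t) = [3 ∣ k ∧ t < L] xor [3 ∣ h ∧ h ∣ (t mod n)],   L = (⌊n/h⌋ + 1) h.
-- The first term is constant on rows and, as n < L ≤ 2n, meets every column in one
-- or two cells; the second is constant on columns and meets every row in one or two
-- cells, a cyclic window of h columns containing one or two multiples of h.  So
-- along a line of length ℓ, β is β₀ or ℓ − β₀ with β₀ ∈ {1, 2} if 3 ∣ ℓ and β₀ = 0
-- otherwise; either way ℓ + β ≢ 0 (mod 3).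
module Submission where

open import Data.Bool using (Bool; true; false; not; _∧_; _xor_; if_then_else_)
open import Data.Bool.Properties using (T-≡; ¬-not; xor-comm)
open import Data.Empty using (⊥-elim)
open import Data.Fin using (Fin; toℕ; #_)
open import Data.Fin.Properties using (toℕ<n; toℕ-fromℕ<)
open import Data.Maybe using (Maybe; just; nothing)
open import Data.Nat
open import Data.Nat.DivMod
open import Data.Nat.Divisibility using (_∣_; _∣?_; ∣⇒≤; ∣m+n∣m⇒∣n; n∣m*n; m%n≡0⇒n∣m)
open import Data.Nat.Properties
open import Data.Nat.Tactic.RingSolver using (solve-∀)
open import Algebra.Properties.CommutativeSemigroup +-commutativeSemigroup
  using (interchange; xy∙z≈xz∙y; xy∙z≈y∙xz; x∙yz≈y∙xz)
open import Data.Product using (Σ; _,_)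
open import Data.Sum using (_⊎_; inj₁; inj₂)
open import Function using (_∘_; Equivalence)
open import Relation.Binary.PropositionalEquality
open import Relation.Nullary using (¬_; Dec; yes; no; does)
open import Relation.Nullary.Decidable using (from-no)
open import Defs

open ≡-Reasoning

𝟙 : Bool → ℕ
𝟙 true  = 1
𝟙 false = 0

∑< : ℕ → (ℕ → ℕ) → ℕ
∑< zero    f = 0
∑< (suc n) f = f 0 + ∑< n (f ∘ suc)

infixl 10 ∑<
syntax ∑< n (λ i → e) = ∑[ i < n ] e

∑-cong : ∀ n {f g : ℕ → ℕ} → (∀ i → i < n → f i ≡ g i) → ∑< n f ≡ ∑< n g
∑-cong zero    _   = refl
∑-cong (suc n) f≗g = cong₂ _+_ (f≗g 0 z<s) (∑-cong n (λ i i<n → f≗g (suc i) (s<s i<n)))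

∑-const : ∀ n c → ∑[ _ < n ] c ≡ n * c
∑-const zero    c = refl
∑-const (suc n) c = cong (c +_) (∑-const n c)

∑-zero : ∀ n {f : ℕ → ℕ} → (∀ i → i < n → f i ≡ 0) → ∑< n f ≡ 0
∑-zero n f≗0 = trans (∑-cong n f≗0) (trans (∑-const n 0) (*-zeroʳ n))

∑-distrib-+ : ∀ n (f g : ℕ → ℕ) → ∑[ i < n ] (f i + g i) ≡ ∑< n f + ∑< n g
∑-distrib-+ zero    f g = refl
∑-distrib-+ (suc n) f g =
  trans (cong (f 0 + g 0 +_) (∑-distrib-+ n (f ∘ suc) (g ∘ suc))) (interchange (f 0) (g 0) _ _)

∑-++ : ∀ a b (f : ℕ → ℕ) → ∑< (a + b) f ≡ ∑< a f + ∑[ i < b ] f (a + i)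
∑-++ zero    b f = refl
∑-++ (suc a) b f = trans (cong (f 0 +_) (∑-++ a b (f ∘ suc))) (sym (+-assoc (f 0) _ _))

∑-≤-++ : ∀ a b (f : ℕ → ℕ) → ∑< a f ≤ ∑< (a + b) f
∑-≤-++ a b f = ≤-trans (m≤m+n _ _) (≤-reflexive (sym (∑-++ a b f)))

∑-swap : ∀ a b (f : ℕ → ℕ → ℕ) → ∑[ x < a ] ∑[ y < b ] f x y ≡ ∑[ y < b ] ∑[ x < a ] f x y
∑-swap zero    b f = sym (∑-zero b (λ _ _ → refl))
∑-swap (suc a) b f =
  trans (cong (∑< b (f 0) +_) (∑-swap a b (f ∘ suc))) (sym (∑-distrib-+ b (f 0) _))

∑-blocks : ∀ a b (f : ℕ → ℕ) → ∑[ x < a ] ∑[ y < b ] f (x * b + y) ≡ ∑< (a * b) f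
∑-blocks zero    b f = refl
∑-blocks (suc a) b f =
  trans (cong (∑< b f +_) (trans reassociate (∑-blocks a b (λ t → f (b + t)))))
        (sym (∑-++ b (a * b) f))
  where
  reassociate : ∑[ x < a ] ∑[ y < b ] f (b + x * b + y) ≡ ∑[ x < a ] ∑[ y < b ] f (b + (x * b + y))
  reassociate = ∑-cong a (λ x _ → ∑-cong b (λ y _ → cong f (+-assoc b (x * b) y)))

∑-delta : ∀ n x (F : ℕ → ℕ) → ∑[ y < n ] (𝟙 (x ≡ᵇ y) * F y) ≡ 𝟙 (x <ᵇ n) * F x
∑-delta zero    x       F = refl
∑-delta (suc n) zero    F = trans (cong (F 0 + 0 +_) (∑-zero n (λ _ _ → refl))) (+-identityʳ _)
∑-delta (suc n) (suc x) F = ∑-delta n x (F ∘ suc)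

Σℕ≡∑ : ∀ n (f : ℕ → ℕ) → Σℕ n (f ∘ toℕ) ≡ ∑< n f
Σℕ≡∑ zero    f = refl
Σℕ≡∑ (suc n) f = cong (f 0 +_) (Σℕ≡∑ n (f ∘ suc))

≡ᵇ-true : ∀ {m n} → m ≡ n → (m ≡ᵇ n) ≡ true
≡ᵇ-true {m} refl = Equivalence.to T-≡ (≡⇒≡ᵇ m m refl)

≡ᵇ-false : ∀ {m n} → m ≢ n → (m ≡ᵇ n) ≡ false
≡ᵇ-false {m} {n} m≢n = ¬-not {y = true} (m≢n ∘ ≡ᵇ⇒≡ m n ∘ Equivalence.from T-≡)

≡ᵇ-comm : ∀ m n → (m ≡ᵇ n) ≡ (n ≡ᵇ m)
≡ᵇ-comm zero    zero    = refl
≡ᵇ-comm zero    (suc n) = refl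
≡ᵇ-comm (suc m) zero    = refl
≡ᵇ-comm (suc m) (suc n) = ≡ᵇ-comm m n

<ᵇ-true : ∀ {m n} → m < n → (m <ᵇ n) ≡ true
<ᵇ-true = Equivalence.to T-≡ ∘ <⇒<ᵇ

<ᵇ-false : ∀ {m n} → n ≤ m → (m <ᵇ n) ≡ false
<ᵇ-false {m} {n} n≤m = ¬-not {y = true} (λ m<ᵇn → <⇒≱ (<ᵇ⇒< m n (Equivalence.from T-≡ m<ᵇn)) n≤m)

∑-delta-< : ∀ n x (F : ℕ → ℕ) → x < n → ∑[ y < n ] (𝟙 (x ≡ᵇ y) * F y) ≡ F x
∑-delta-< n x F x<n =
  trans (∑-delta n x F) (trans (cong (λ b → 𝟙 b * F x) (<ᵇ-true x<n)) (*-identityˡ (F x)))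

[m%n+k]%n≡[m+k]%n : ∀ m k n .{{_ : NonZero n}} → (m % n + k) % n ≡ (m + k) % n
[m%n+k]%n≡[m+k]%n m k n = begin
  (m % n + k) % n         ≡⟨ %-distribˡ-+ (m % n) k n ⟩
  (m % n % n + k % n) % n ≡⟨ cong (λ x → (x + k % n) % n) (m%n%n≡m%n m n) ⟩
  (m % n + k % n) % n     ≡⟨ %-distribˡ-+ m k n ⟨
  (m + k) % n             ∎

[k+m%n]%n≡[k+m]%n : ∀ k m n .{{_ : NonZero n}} → (k + m % n) % n ≡ (k + m) % n
[k+m%n]%n≡[k+m]%n k m n = begin
  (k + m % n) % n ≡⟨ cong (_% n) (+-comm k (m % n)) ⟩
  (m % n + k) % n ≡⟨ [m%n+k]%n≡[m+k]%n m k n ⟩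
  (m + k) % n     ≡⟨ cong (_% n) (+-comm m k) ⟩
  (k + m) % n     ∎

[q*n+r]%n≡r : ∀ q {n r} .{{_ : NonZero n}} → r < n → (q * n + r) % n ≡ r
[q*n+r]%n≡r q {n} {r} r<n = trans (%-remove-+ˡ r (n∣m*n q)) (m<n⇒m%n≡m r<n)

[i*h+s<ᵇP*h]≡[i<ᵇP] : ∀ i P {h s} → s < h → (i * h + s <ᵇ P * h) ≡ (i <ᵇ P)
[i*h+s<ᵇP*h]≡[i<ᵇP] i P {h} {s} s<h with i <? P
... | yes i<P = trans (<ᵇ-true i*h+s<P*h) (sym (<ᵇ-true i<P))
  where
  i*h+s<P*h : i * h + s < P * h
  i*h+s<P*h = <-≤-trans (+-monoʳ-< (i * h) s<h)
                        (≤-trans (≤-reflexive (+-comm (i * h) h)) (*-monoˡ-≤ h i<P))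
... | no  i≮P = trans (<ᵇ-false (≤-trans (*-monoˡ-≤ h (≮⇒≥ i≮P)) (m≤m+n (i * h) s)))
                      (sym (<ᵇ-false (≮⇒≥ i≮P)))

-- (j − c) mod n, written without truncated subtraction
offset : (n c j : ℕ) .{{_ : NonZero n}} → ℕ
offset n c j = (j + (n ∸ c % n)) % n

c+[n∸c%n]≡[1+c/n]*n : ∀ n c .{{_ : NonZero n}} → c + (n ∸ c % n) ≡ suc (c / n) * n
c+[n∸c%n]≡[1+c/n]*n n c = begin
  c + (n ∸ c % n)                 ≡⟨ cong (_+ (n ∸ c % n)) (m≡m%n+[m/n]*n c n) ⟩
  c % n + c / n * n + (n ∸ c % n) ≡⟨ xy∙z≈xz∙y (c % n) _ _ ⟩
  c % n + (n ∸ c % n) + c / n * n ≡⟨ cong (_+ c / n * n) (m+[n∸m]≡n (<⇒≤ (m%n<n c n))) ⟩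
  suc (c / n) * n                 ∎

[x+[c+[n∸c%n]]]%n≡x%n : ∀ n c x .{{_ : NonZero n}} → (x + (c + (n ∸ c % n))) % n ≡ x % n
[x+[c+[n∸c%n]]]%n≡x%n n c x =
  trans (cong (λ y → (x + y) % n) (c+[n∸c%n]≡[1+c/n]*n n c)) ([m+kn]%n≡m%n x (suc (c / n)) n)

offset-+ : ∀ n c s .{{_ : NonZero n}} → s < n → offset n c ((c + s) % n) ≡ s
offset-+ n c s s<n = begin
  ((c + s) % n + d) % n ≡⟨ [m%n+k]%n≡[m+k]%n (c + s) d n ⟩
  (c + s + d) % n       ≡⟨ cong (_% n) (xy∙z≈y∙xz c s d) ⟩
  (s + (c + d)) % n     ≡⟨ [x+[c+[n∸c%n]]]%n≡x%n n c s ⟩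
  s % n                 ≡⟨ m<n⇒m%n≡m s<n ⟩
  s                     ∎
  where d = n ∸ c % n

+-offset : ∀ n c j .{{_ : NonZero n}} → j < n → (c + offset n c j) % n ≡ j
+-offset n c j j<n = begin
  (c + (j + d) % n) % n ≡⟨ [k+m%n]%n≡[k+m]%n c (j + d) n ⟩
  (c + (j + d)) % n     ≡⟨ cong (_% n) (sym (x∙yz≈y∙xz j c d)) ⟩
  (j + (c + d)) % n     ≡⟨ [x+[c+[n∸c%n]]]%n≡x%n n c j ⟩
  j % n                 ≡⟨ m<n⇒m%n≡m j<n ⟩
  j                     ∎
  where d = n ∸ c % n

[c+s]%n≡ᵇj≡offset≡ᵇs : ∀ n c s j .{{_ : NonZero n}} → s < n → j < n →
                       ((c + s) % n ≡ᵇ j) ≡ (offset n c j ≡ᵇ s)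
[c+s]%n≡ᵇj≡offset≡ᵇs n c s j s<n j<n with (c + s) % n ≟ j
... | yes refl = trans (≡ᵇ-true {(c + s) % n} refl) (sym (≡ᵇ-true (offset-+ n c s s<n)))
... | no  ≢j   = trans (≡ᵇ-false ≢j) (sym (≡ᵇ-false offset≢s))
  where
  offset≢s : offset n c j ≢ s
  offset≢s refl = ≢j (+-offset n c j j<n)

∑-shift-delta : ∀ n c j h (G : ℕ → ℕ) .{{_ : NonZero n}} → j < n → h ≤ n →
                ∑[ s < h ] (𝟙 ((c + s) % n ≡ᵇ j) * G s) ≡ 𝟙 (offset n c j <ᵇ h) * G (offset n c j)
∑-shift-delta n c j h G j<n h≤n =
  trans (∑-cong h (λ s s<h → cong (λ b → 𝟙 b * G s)
                                  ([c+s]%n≡ᵇj≡offset≡ᵇs n c s j (<-≤-trans s<h h≤n) j<n)))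
        (∑-delta h (offset n c j) G)

-- Row i occupies the columns (i h + s) mod n for s < h; its cell in column j is
-- the (index i j)-th cell of the filling.
module CyclicFilling (n h : ℕ) .{{_ : NonZero n}} (h≤n : h ≤ n) where

  position : ℕ → ℕ → ℕ
  position i j = offset n (i * h) j

  occupied : ℕ → ℕ → Bool
  occupied i j = position i j <ᵇ h

  index : ℕ → ℕ → ℕ
  index i j = i * h + position i j

  ∑-row : ∀ i (F : ℕ → ℕ) →
          ∑[ j < n ] (𝟙 (occupied i j) * F (index i j)) ≡ ∑[ s < h ] F (i * h + s)
  ∑-row i F = begin
    ∑[ j < n ] (𝟙 (occupied i j) * F (index i j))
      ≡⟨ ∑-cong n (λ j j<n → ∑-shift-delta n c j h (λ s → F (c + s)) j<n h≤n) ⟨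
    ∑[ j < n ] ∑[ s < h ] (𝟙 ((c + s) % n ≡ᵇ j) * F (c + s))
      ≡⟨ ∑-swap n h _ ⟩
    ∑[ s < h ] ∑[ j < n ] (𝟙 ((c + s) % n ≡ᵇ j) * F (c + s))
      ≡⟨ ∑-cong h (λ s _ → ∑-delta-< n ((c + s) % n) (λ _ → F (c + s)) (m%n<n (c + s) n)) ⟩
    ∑[ s < h ] F (c + s) ∎
    where c = i * h

  ∑-column : ∀ m k j (F : ℕ → ℕ) → m * h ≡ k * n → j < n →
             ∑[ i < m ] (𝟙 (occupied i j) * F (index i j)) ≡ ∑[ q < k ] F (q * n + j)
  ∑-column m k j F mh≡kn j<n = begin
    ∑[ i < m ] (𝟙 (occupied i j) * F (index i j))
      ≡⟨ ∑-cong m (λ i _ → ∑-shift-delta n (i * h) j h (λ s → F (i * h + s)) j<n h≤n) ⟨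
    ∑[ i < m ] ∑[ s < h ] G (i * h + s)
      ≡⟨ ∑-blocks m h G ⟩
    ∑< (m * h) G
      ≡⟨ cong (λ x → ∑< x G) mh≡kn ⟩
    ∑< (k * n) G
      ≡⟨ ∑-blocks k n G ⟨
    ∑[ q < k ] ∑[ r < n ] G (q * n + r)
      ≡⟨ ∑-cong k (λ q _ → ∑-cong n (λ r r<n → cong (λ b → 𝟙 b * F (q * n + r)) (in-column q r<n))) ⟩
    ∑[ q < k ] ∑[ r < n ] (𝟙 (j ≡ᵇ r) * F (q * n + r))
      ≡⟨ ∑-cong k (λ q _ → ∑-delta-< n j (λ r → F (q * n + r)) j<n) ⟩
    ∑[ q < k ] F (q * n + j) ∎
    where
    G : ℕ → ℕ
    G t = 𝟙 (t % n ≡ᵇ j) * F t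
    in-column : ∀ q {r} → r < n → ((q * n + r) % n ≡ᵇ j) ≡ (j ≡ᵇ r)
    in-column q {r} r<n = trans (cong (_≡ᵇ j) ([q*n+r]%n≡r q r<n)) (≡ᵇ-comm r j)

OneOrTwo : ℕ → Set
OneOrTwo v = v ≡ 1 ⊎ v ≡ 2

3∤OneOrTwo : ∀ {v} → OneOrTwo v → ¬ 3 ∣ v
3∤OneOrTwo (inj₁ refl) = from-no (3 ∣? 1)
3∤OneOrTwo (inj₂ refl) = from-no (3 ∣? 2)

≤1⇒OneOrTwo[+1] : ∀ {v} → v ≤ 1 → OneOrTwo (v + 1)
≤1⇒OneOrTwo[+1] z≤n       = inj₁ refl
≤1⇒OneOrTwo[+1] (s≤s z≤n) = inj₂ refl

∑-window-multiple : ∀ h c .{{_ : NonZero h}} → ∑[ s < h ] 𝟙 ((c + s) % h ≡ᵇ 0) ≡ 1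
∑-window-multiple h c = begin
  ∑[ s < h ] 𝟙 ((c + s) % h ≡ᵇ 0)         ≡⟨ ∑-cong h (λ s _ → *-identityʳ _) ⟨
  ∑[ s < h ] (𝟙 ((c + s) % h ≡ᵇ 0) * 1)   ≡⟨ ∑-shift-delta h c 0 h (λ _ → 1) (>-nonZero⁻¹ h) ≤-refl ⟩
  𝟙 (offset h c 0 <ᵇ h) * 1               ≡⟨ cong (λ b → 𝟙 b * 1) (<ᵇ-true (m%n<n _ h)) ⟩
  1                                       ∎

∑-initial-multiple : ∀ h e .{{_ : NonZero h}} → 0 < e → e ≤ h → ∑[ s < e ] 𝟙 (s % h ≡ᵇ 0) ≡ 1
∑-initial-multiple h (suc e) _ e<h = cong₂ _+_ (cong 𝟙 (≡ᵇ-true (m*n%n≡0 0 h))) (∑-zero e nonmultiple)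
  where
  nonmultiple : ∀ s → s < e → 𝟙 (suc s % h ≡ᵇ 0) ≡ 0
  nonmultiple s s<e = cong 𝟙 (≡ᵇ-false (λ eq → 1+n≢0 (trans (sym suc-s%h≡suc-s) eq)))
    where
    suc-s%h≡suc-s : suc s % h ≡ suc s
    suc-s%h≡suc-s = m<n⇒m%n≡m (<-≤-trans (s<s s<e) e<h)

∑-wrapped-window-multiples : ∀ n h r .{{_ : NonZero n}} .{{_ : NonZero h}} → h ≤ n → r < n → n < r + h →
                             OneOrTwo (∑[ s < h ] 𝟙 (((r + s) % n) % h ≡ᵇ 0))
∑-wrapped-window-multiples n h r h≤n r<n n<r+h =
  subst OneOrTwo (sym total) (≤1⇒OneOrTwo[+1] before-wrap≤1)
  where
  a = n ∸ r
  e = h ∸ a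
  a<h : a < h
  a<h = m<n+o⇒m∸n<o n r n<r+h
  h≡a+e : h ≡ a + e
  h≡a+e = sym (m+[n∸m]≡n (<⇒≤ a<h))
  f g : ℕ → ℕ
  f s = 𝟙 (((r + s) % n) % h ≡ᵇ 0)
  g s = 𝟙 ((r + s) % h ≡ᵇ 0)
  r+a≡n : r + a ≡ n
  r+a≡n = m+[n∸m]≡n (<⇒≤ r<n)
  before-wrap : ∑< a f ≡ ∑< a g
  before-wrap = ∑-cong a (λ s s<a → cong (λ x → 𝟙 (x % h ≡ᵇ 0))
                  (m<n⇒m%n≡m (subst (r + s <_) r+a≡n (+-monoʳ-< r s<a))))
  before-wrap≤1 : ∑< a g ≤ 1
  before-wrap≤1 = ≤-trans (∑-≤-++ a e g)
                    (≤-reflexive (trans (cong (λ x → ∑< x g) (sym h≡a+e)) (∑-window-multiple h r)))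
  wrap : ∀ y → y < e → (r + (a + y)) % n ≡ y
  wrap y y<e = begin
    (r + (a + y)) % n ≡⟨ cong (_% n) (trans (sym (+-assoc r a y)) (cong (_+ y) r+a≡n)) ⟩
    (n + y) % n       ≡⟨ cong (_% n) (+-comm n y) ⟩
    (y + n) % n       ≡⟨ [m+n]%n≡m%n y n ⟩
    y % n             ≡⟨ m<n⇒m%n≡m (<-≤-trans y<e (≤-trans (m∸n≤m h a) h≤n)) ⟩
    y                 ∎
  after-wrap : ∑[ y < e ] f (a + y) ≡ 1
  after-wrap = trans (∑-cong e (λ y y<e → cong (λ x → 𝟙 (x % h ≡ᵇ 0)) (wrap y y<e)))
                     (∑-initial-multiple h e (m<n⇒0<n∸m a<h) (m∸n≤m h a))
  total : ∑< h f ≡ ∑< a g + 1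
  total = trans (cong (λ x → ∑< x f) h≡a+e) (trans (∑-++ a e f) (cong₂ _+_ before-wrap after-wrap))

∑-cyclic-window-multiples : ∀ n h r .{{_ : NonZero n}} .{{_ : NonZero h}} → h ≤ n →
                            OneOrTwo (∑[ s < h ] 𝟙 (((r + s) % n) % h ≡ᵇ 0))
∑-cyclic-window-multiples n h r h≤n =
  subst OneOrTwo (∑-cong h (λ s _ → cong (λ x → 𝟙 (x % h ≡ᵇ 0)) ([m%n+k]%n≡[m+k]%n r s n)))
        (reduced (r % n) (m%n<n r n))
  where
  reduced : ∀ r → r < n → OneOrTwo (∑[ s < h ] 𝟙 (((r + s) % n) % h ≡ᵇ 0))
  reduced r r<n with r + h ≤? n
  ... | no  r+h≰n = ∑-wrapped-window-multiples n h r h≤n r<n (≰⇒> r+h≰n)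
  ... | yes r+h≤n = inj₁ (trans (∑-cong h (λ s s<h → cong (λ x → 𝟙 (x % h ≡ᵇ 0)) (within s s<h)))
                                (∑-window-multiple h r))
    where
    within : ∀ s → s < h → (r + s) % n ≡ r + s
    within s s<h = m<n⇒m%n≡m (<-≤-trans (+-monoʳ-< r s<h) r+h≤n)

∑-below-threshold : ∀ k n j L → 2 ≤ k → j < n → n ≤ L → L ≤ n + n →
                    OneOrTwo (∑[ q < k ] 𝟙 (q * n + j <ᵇ L))
∑-below-threshold (suc zero)    _ _ _ (s≤s ()) _ _ _
∑-below-threshold (suc (suc k)) n j L _ j<n n≤L L≤n+n
  rewrite <ᵇ-true (<-≤-trans j<n n≤L)
        | ∑-zero k (λ q _ → cong 𝟙 (<ᵇ-false (≤-trans L≤n+n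
            (≤-trans (+-monoʳ-≤ n (m≤m+n n (q * n))) (m≤m+n _ j)))))
  with 1 * n + j <ᵇ L
... | true  = inj₂ refl
... | false = inj₁ refl

∑-not+∑ : ∀ ℓ (w : ℕ → Bool) → ∑[ s < ℓ ] 𝟙 (not (w s)) + ∑[ s < ℓ ] 𝟙 (w s) ≡ ℓ
∑-not+∑ ℓ w = begin
  ∑[ s < ℓ ] 𝟙 (not (w s)) + ∑[ s < ℓ ] 𝟙 (w s) ≡⟨ ∑-distrib-+ ℓ _ _ ⟨
  ∑[ s < ℓ ] (𝟙 (not (w s)) + 𝟙 (w s))          ≡⟨ ∑-cong ℓ (λ s _ → 𝟙-not+𝟙 (w s)) ⟩
  ∑[ _ < ℓ ] 1                                  ≡⟨ ∑-const ℓ 1 ⟩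
  ℓ * 1                                         ≡⟨ *-identityʳ ℓ ⟩
  ℓ                                             ∎
  where
  𝟙-not+𝟙 : ∀ b → 𝟙 (not b) + 𝟙 b ≡ 1
  𝟙-not+𝟙 true  = refl
  𝟙-not+𝟙 false = refl

line-sum-nonzero : ∀ ℓ (3∣?ℓ : Dec (3 ∣ ℓ)) a (w : ℕ → Bool) →
                   (3 ∣ ℓ → OneOrTwo (∑[ s < ℓ ] 𝟙 (w s))) →
                   ¬ 3 ∣ ℓ + ∑[ s < ℓ ] 𝟙 (a xor (does 3∣?ℓ ∧ w s))
line-sum-nonzero ℓ (yes 3∣ℓ) false w hits = λ 3∣sum →
  3∤OneOrTwo (hits 3∣ℓ) (∣m+n∣m⇒∣n 3∣sum 3∣ℓ)
line-sum-nonzero ℓ (yes 3∣ℓ) true  w hits = λ 3∣sum →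
  3∤OneOrTwo (hits 3∣ℓ)
    (∣m+n∣m⇒∣n (subst (3 ∣_) (sym (∑-not+∑ ℓ w)) 3∣ℓ) (∣m+n∣m⇒∣n 3∣sum 3∣ℓ))
line-sum-nonzero ℓ (no 3∤ℓ)  false _ _ = λ 3∣sum →
  3∤ℓ (subst (3 ∣_) (trans (cong (ℓ +_) (∑-zero ℓ (λ _ _ → refl))) (+-identityʳ ℓ)) 3∣sum)
line-sum-nonzero ℓ (no 3∤ℓ)  true  _ _ = λ 3∣sum →
  3∤ℓ (∣m+n∣m⇒∣n (subst (3 ∣_) (triple ℓ) (n∣m*n ℓ))
                  (subst (λ x → 3 ∣ ℓ + x) (∑-const ℓ 1) 3∣sum))
  where
  triple : ∀ l → l * 3 ≡ l + l * 1 + l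
  triple = solve-∀

open Zmod 3

value : Maybe Z → ℕ
value nothing  = 0
value (just x) = toℕ x

toℕ-ΣZ : ∀ n (f : Fin n → Maybe Z) → toℕ (ΣZ n f) ≡ Σℕ n (value ∘ f) % 3
toℕ-ΣZ zero    f = refl
toℕ-ΣZ (suc n) f with f Fin.zero
... | nothing = toℕ-ΣZ n (f ∘ Fin.suc)
... | just x  = begin
  toℕ ((toℕ x + toℕ (ΣZ n (f ∘ Fin.suc))) mod 3) ≡⟨ toℕ-fromℕ< _ ⟩
  (toℕ x + toℕ (ΣZ n (f ∘ Fin.suc))) % 3         ≡⟨ cong (λ y → (toℕ x + y) % 3) (toℕ-ΣZ n (f ∘ Fin.suc)) ⟩
  (toℕ x + Σℕ n (value ∘ f ∘ Fin.suc) % 3) % 3   ≡⟨ [k+m%n]%n≡[k+m]%n (toℕ x) _ 3 ⟩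
  (toℕ x + Σℕ n (value ∘ f ∘ Fin.suc)) % 3       ∎

ΣZ≡0z⇒3∣ : ∀ n (f : Fin n → Maybe Z) → ΣZ n f ≡ 0z → 3 ∣ Σℕ n (value ∘ f)
ΣZ≡0z⇒3∣ n f sum≡0 = m%n≡0⇒n∣m _ 3 (trans (sym (toℕ-ΣZ n f)) (cong toℕ sum≡0))

digit : Bool → Z
digit false = # 1
digit true  = # 2

∑-digits : ∀ ℓ (b : ℕ → Bool) → ∑[ s < ℓ ] value (just (digit (b s))) ≡ ℓ + ∑[ s < ℓ ] 𝟙 (b s)
∑-digits ℓ b = begin
  ∑[ s < ℓ ] value (just (digit (b s))) ≡⟨ ∑-cong ℓ (λ s _ → value-digit (b s)) ⟩
  ∑[ s < ℓ ] (1 + 𝟙 (b s))              ≡⟨ ∑-distrib-+ ℓ (λ _ → 1) _ ⟩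
  ∑[ _ < ℓ ] 1 + ∑[ s < ℓ ] 𝟙 (b s)     ≡⟨ cong (_+ ∑[ s < ℓ ] 𝟙 (b s)) (trans (∑-const ℓ 1) (*-identityʳ ℓ)) ⟩
  ℓ + ∑[ s < ℓ ] 𝟙 (b s)                ∎
  where
  value-digit : ∀ b → value (just (digit b)) ≡ 1 + 𝟙 b
  value-digit true  = refl
  value-digit false = refl

occurrences : Z → Maybe Z → ℕ
occurrences g c = isG g c + isG (-z g) c

occurrences-digit : ∀ g b → occurrences g (just (digit b)) ≡ occurrences g (just (# 1))
occurrences-digit g                              false = refl
occurrences-digit Fin.zero                       true  = refl
occurrences-digit (Fin.suc Fin.zero)             true  = refl
occurrences-digit (Fin.suc (Fin.suc Fin.zero))   true  = refl

occurrences-nonzero : ∀ g → g ≢ 0z → occurrences g (just (# 1)) ≡ 1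
occurrences-nonzero Fin.zero                     g≢0 = ⊥-elim (g≢0 refl)
occurrences-nonzero (Fin.suc Fin.zero)           _   = refl
occurrences-nonzero (Fin.suc (Fin.suc Fin.zero)) _   = refl

module Construction (m n h k : ℕ) .{{_ : NonZero n}} .{{_ : NonZero h}}
                    (h≤n : h ≤ n) (mh≡kn : m * h ≡ k * n) (0<k : 0 < k) where

  open CyclicFilling n h h≤n

  L : ℕ
  L = suc (n / h) * h

  n≤L : n ≤ L
  n≤L = ≤-trans (≤-reflexive (m≡m%n+[m/n]*n n h)) (+-monoˡ-≤ (n / h * h) (<⇒≤ (m%n<n n h)))

  L≤n+n : L ≤ n + n
  L≤n+n = +-mono-≤ h≤n (m/n*n≤m n h)

  bit : ℕ → Bool
  bit t = (does (3 ∣? k) ∧ (t <ᵇ L)) xor (does (3 ∣? h) ∧ ((t % n) % h ≡ᵇ 0))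

  cell : ℕ → ℕ → Maybe Z
  cell i j = if occupied i j then just (digit (bit (index i j))) else nothing

  A : PFArray m n
  A i j = cell (toℕ i) (toℕ j)

  cell-measure : (Φ : Maybe Z → ℕ) → Φ nothing ≡ 0 → ∀ i j →
                 Φ (cell i j) ≡ 𝟙 (occupied i j) * Φ (just (digit (bit (index i j))))
  cell-measure Φ Φ∅ i j with occupied i j
  ... | true  = sym (+-identityʳ _)
  ... | false = Φ∅

  ∑-row-cells : (Φ : Maybe Z → ℕ) → Φ nothing ≡ 0 → ∀ i →
                Σℕ n (Φ ∘ cell i ∘ toℕ) ≡ ∑[ s < h ] Φ (just (digit (bit (i * h + s))))
  ∑-row-cells Φ Φ∅ i =
    trans (Σℕ≡∑ n (Φ ∘ cell i))
          (trans (∑-cong n (λ j _ → cell-measure Φ Φ∅ i j)) (∑-row i (Φ ∘ just ∘ digit ∘ bit)))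

  ∑-column-cells : (Φ : Maybe Z → ℕ) → Φ nothing ≡ 0 → ∀ j → j < n →
                   Σℕ m (λ i → Φ (cell (toℕ i) j)) ≡ ∑[ q < k ] Φ (just (digit (bit (q * n + j))))
  ∑-column-cells Φ Φ∅ j j<n =
    trans (Σℕ≡∑ m (λ i → Φ (cell i j)))
          (trans (∑-cong m (λ i _ → cell-measure Φ Φ∅ i j))
                 (∑-column m k j (Φ ∘ just ∘ digit ∘ bit) mh≡kn j<n))

  mult≡ : ∀ g → mult A g ≡ m * (h * occurrences g (just (# 1)))
  mult≡ g = begin
    mult A g
      ≡⟨ Σℕ≡∑ m (λ i → Σℕ n (occurrences g ∘ cell i ∘ toℕ)) ⟩
    ∑[ i < m ] Σℕ n (occurrences g ∘ cell i ∘ toℕ)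
      ≡⟨ ∑-cong m (λ i _ → trans (∑-row-cells (occurrences g) refl i)
                                 (trans (∑-cong h (λ s _ → occurrences-digit g (bit (i * h + s)))) (∑-const h _))) ⟩
    ∑[ _ < m ] (h * occurrences g (just (# 1)))
      ≡⟨ ∑-const m _ ⟩
    m * (h * occurrences g (just (# 1))) ∎

  rowSum-nonzero : ∀ i → rowSum A i ≢ 0z
  rowSum-nonzero i sum≡0 =
    line-sum-nonzero h (3 ∣? h) a w (λ _ → ∑-cyclic-window-multiples n h c h≤n)
      (subst (3 ∣_) row-total (ΣZ≡0z⇒3∣ n (A i) sum≡0))
    where
    c = toℕ i * h
    a = does (3 ∣? k) ∧ (toℕ i <ᵇ suc (n / h))
    w : ℕ → Bool
    w s = ((c + s) % n) % h ≡ᵇ 0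
    row-total : Σℕ n (value ∘ A i) ≡ h + ∑[ s < h ] 𝟙 (a xor (does (3 ∣? h) ∧ w s))
    row-total =
      trans (∑-row-cells value refl (toℕ i))
        (trans (∑-digits h (λ s → bit (c + s)))
          (cong (h +_) (∑-cong h (λ s s<h → cong (λ x → 𝟙 ((does (3 ∣? k) ∧ x) xor (does (3 ∣? h) ∧ w s)))
                                                  ([i*h+s<ᵇP*h]≡[i<ᵇP] (toℕ i) (suc (n / h)) s<h)))))

  columnSum-nonzero : ∀ j → colSum A j ≢ 0z
  columnSum-nonzero j sum≡0 =
    line-sum-nonzero k (3 ∣? k) a w below (subst (3 ∣_) column-total (ΣZ≡0z⇒3∣ m (λ i → A i j) sum≡0))
    where
    a = does (3 ∣? h) ∧ (toℕ j % h ≡ᵇ 0)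
    w : ℕ → Bool
    w q = q * n + toℕ j <ᵇ L
    below : 3 ∣ k → OneOrTwo (∑[ q < k ] 𝟙 (w q))
    below 3∣k = ∑-below-threshold k n (toℕ j) L (≤-trans (n≤1+n 2) (∣⇒≤ {{>-nonZero 0<k}} 3∣k))
                                  (toℕ<n j) n≤L L≤n+n
    bit-column : ∀ q → bit (q * n + toℕ j) ≡ a xor (does (3 ∣? k) ∧ w q)
    bit-column q = trans (cong (λ x → (does (3 ∣? k) ∧ w q) xor (does (3 ∣? h) ∧ (x % h ≡ᵇ 0)))
                               ([q*n+r]%n≡r q (toℕ<n j)))
                         (xor-comm _ a)
    column-total : Σℕ m (λ i → value (A i j)) ≡ k + ∑[ q < k ] 𝟙 (a xor (does (3 ∣? k) ∧ w q))
    column-total =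
      trans (∑-column-cells value refl (toℕ j) (toℕ<n j))
        (trans (∑-digits k (λ q → bit (q * n + toℕ j)))
          (cong (k +_) (∑-cong k (λ q _ → cong 𝟙 (bit-column q)))))

  isNH : IsNH (m * h) m n h k A
  isNH = record
    { rowFilled = λ i → trans (∑-row-cells filled refl (toℕ i)) (trans (∑-const h 1) (*-identityʳ h))
    ; colFilled = λ j → trans (∑-column-cells filled refl (toℕ j) (toℕ<n j))
                              (trans (∑-const k 1) (*-identityʳ k))
    ; multJ     = trans (mult≡ 0z) (trans (cong (m *_) (*-zeroʳ h)) (*-zeroʳ m))
    ; multOut   = λ g g≢0 → trans (mult≡ g)
                    (cong (m *_) (trans (cong (h *_) (occurrences-nonzero g g≢0)) (*-identityʳ h)))
    ; rowNZ     = rowSum-nonzero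
    ; colNZ     = columnSum-nonzero
    }

theorem3p1 : (lam m n h k : ℕ) → 0 < lam → 0 < m → 0 < n → 0 < h → 0 < k →
    h ≤ n → k ≤ m → n * k ≡ m * h → 3 * lam ≡ 2 * (n * k) + lam →
    Σ (Zmod.PFArray 3 m n) (λ A → Zmod.IsNH 3 lam m n h k A)
theorem3p1 lam m n h k _ _ 0<n 0<h 0<k h≤n _ nk≡mh 3λ≡2nk+λ =
  A , subst (λ l → IsNH l m n h k A) (sym λ≡mh) isNH
  where
  open Construction m n h k {{>-nonZero 0<n}} {{>-nonZero 0<h}} h≤n
                    (trans (sym nk≡mh) (*-comm n k)) 0<k
  λ≡mh : lam ≡ m * h
  λ≡mh = trans (*-cancelˡ-≡ lam (n * k) 2
                 (+-cancelʳ-≡ lam (2 * lam) (2 * (n * k)) (trans (+-comm (2 * lam) lam) 3λ≡2nk+λ)))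
               nk≡mh
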